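{- Let $k\geq 1$ be an integer and define the $k$-bonacci numbers $f_n^{(k)}$ for all integers $n$ by $f_n^{(k)}=0$ for $n<0$, $f_0^{(k)}=1$, and $f_n^{(k)}=\sum_{i=1}^k f_{n-i}^{(k)}$ for $n\geq 1$. Then for every integer $n\geq 0$, \[ f_n^{(k)}=\sum_{j=0}^{\lfloor n/(k+1)\rfloor}(-1)^j\,\frac{(n-jk)+j+\delta_{n,0}}{2(n-jk)+\delta_{n,0}}\binom{n-jk}{j}\,2^{\,n-j(k+1)}, \] where the right-hand side is computed in the rational numbers.
   Context: $\lfloor x\rfloor$ denotes the largest integer less than or equal to $x$. $\delta_{n,0}$ is the Kronecker delta: $\delta_{n,0}=1$ if $n=0$ and $\delta_{n,0}=0$ otherwise. -}

module Defs where

open import Data.Nat using (ℕ; zero; suc; _+_; _*_; _∸_; _^_; _/_; NonZero)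
open import Data.Nat.Combinatorics using (_C_)
open import Data.List using (List; []; _∷_; take; map; upTo; foldr)
open import Data.Nat.ListAction using (sum)
open import Data.Integer using (ℤ; +_; -[1+_])
import Data.Rational as ℚ
open ℚ using (ℚ)

-- History of k-bonacci values, newest first: kbHist k n = [f_n, f_{n-1}, ..., f_0].
-- f_{n+1} = sum_{i=1}^{k} f_{n+1-i}, where the terms with negative index are 0;
-- 'take k' of the history simply drops those (zero) terms.
kbHist : ℕ → ℕ → List ℕ
kbHist k zero    = 1 ∷ []
kbHist k (suc n) = sum (take k (kbHist k n)) ∷ kbHist k n

headℕ : List ℕ → ℕ
headℕ []      = 0
headℕ (x ∷ _) = x

kbonacci : ℕ → ℤ → ℕ
kbonacci k (+ n)    = headℕ (kbHist k n)
kbonacci k -[1+ n ] = 0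

δ₀ : ℕ → ℕ
δ₀ zero    = 1
δ₀ (suc _) = 0

sign : ℕ → ℤ
sign zero          = + 1
sign (suc zero)    = -[1+ 0 ]
sign (suc (suc j)) = sign j

-- rational a/b; only used with b ≠ 0 (b = 0 is never reached in the theorem's range)
frac : ℤ → ℕ → ℚ
frac a zero    = ℚ.0ℚ
frac a (suc b) = a ℚ./ suc b

term : ℕ → ℕ → ℕ → ℚ
term k n j =
  let m = n ∸ j * k in
  frac (sign j Data.Integer.* + (m + j + δ₀ n)) (2 * m + δ₀ n)
    ℚ.* ((+ (m C j)) ℚ./ 1)
    ℚ.* ((+ (2 ^ (n ∸ j * (k + 1)))) ℚ./ 1)

sumℚ : List ℚ → ℚ
sumℚ = foldr ℚ._+_ ℚ.0ℚ

rhs : ℕ → ℕ → ℚ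
rhs k n = sumℚ (map (term k n) (upTo (suc (n / suc k))))

module Submission where

-- With b(m, j) = C(m, j)·2^(m-j), let S_n = Σ_j (-1)^j b(n - jk, j), a finite sum. Pascal's rule
-- b(m+1, j+1) = 2·b(m, j+1) + b(m, j) yields S_{n+1} = 2·S_n - S_{n-k} for n ≥ k, and S_n = 2^n
-- for n ≤ k. Hence the differences S_n - S_{n-1} (with S_{-1} = 0) start with 1 and satisfy the
-- k-bonacci recurrence, because S_{n+1} - S_n = S_n - S_{n-k} telescopes into the sum of the last
-- k differences; so f_n = S_n - S_{n-1}. Finally the absorption identity (m - j)·C(m, j) = m·C(m-1, j)
-- gives (m + j)/(2m)·b(m, j) = b(m, j) - b(m-1, j), so with m = n - jk the j-th summand of the
-- formula is the difference of the j-th summands of S_n and S_{n-1}.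

open import Defs
open import Data.Nat using (ℕ; _≥_)
open import Data.Integer using (+_)
open import Data.Rational using (_/_)
open import Relation.Binary.PropositionalEquality using (_≡_)

open import Data.Nat.Base as ℕ using (zero; suc; _≤_; _<_; z≤n; s≤s; z<s; _∸_; _^_; NonZero)
import Data.Nat.Properties as ℕ
open import Data.Nat.DivMod using (m*n/n≡m; m/n≤m; /-monoˡ-≤; m<n⇒m/n≡0)
open import Data.Nat.Combinatorics using (_C_; k>n⇒nCk≡0; nCk+nC[k+1]≡[n+1]C[k+1]; nC1≡n)
import Data.Nat.Tactic.RingSolver as ℕ-Solver
open import Algebra.Properties.CommutativeSemigroup ℕ.*-commutativeSemigroup using (x∙yz≈y∙xz)
open import Data.Integer.Base using (ℤ; 0ℤ; _+_; _*_; -_; _-_)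
import Data.Integer.Properties as ℤ
open import Data.Integer.Tactic.RingSolver using (solve-∀)
open import Data.Sum.Base using (inj₁; inj₂)
open import Data.Rational.Base as ℚ using (ℚ; toℚᵘ)
import Data.Rational.Properties as ℚ
import Data.Rational.Unnormalised.Base as ℚᵘ
import Data.Rational.Unnormalised.Properties as ℚᵘ
open import Function.Base using (_∘_; id)
open import Data.List.Base using (List; []; _∷_; take; map; foldr; applyUpTo; applyDownFrom)
open import Data.List.Properties using (take-map; map-applyUpTo; foldr-fusion; foldr-map; ∷-injectiveˡ)
open import Data.Nat.ListAction using (sum)
open import Data.Empty using (⊥-elim)
open import Relation.Binary.PropositionalEquality
  using (refl; sym; trans; cong; cong₂; subst; module ≡-Reasoning)

[k+1]*[n+1]C[k+1]≡[n+1]*nCk : ∀ n k → suc k ℕ.* (suc n C suc k) ≡ suc n ℕ.* (n C k)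
[k+1]*[n+1]C[k+1]≡[n+1]*nCk n zero =
  trans (ℕ.*-identityˡ _) (trans (nC1≡n (suc n)) (sym (ℕ.*-identityʳ (suc n))))
[k+1]*[n+1]C[k+1]≡[n+1]*nCk zero (suc k) = ℕ.*-zeroʳ (suc (suc k))
[k+1]*[n+1]C[k+1]≡[n+1]*nCk (suc n) (suc k) = begin
  suc (suc k) ℕ.* (suc (suc n) C suc (suc k))
    ≡⟨ cong (suc (suc k) ℕ.*_) (sym (nCk+nC[k+1]≡[n+1]C[k+1] (suc n) (suc k))) ⟩
  suc (suc k) ℕ.* (X ℕ.+ W)
    ≡⟨ split (suc k) X W ⟩
  X ℕ.+ (suc k ℕ.* X ℕ.+ suc (suc k) ℕ.* W)
    ≡⟨ cong₂ (λ a b → X ℕ.+ (a ℕ.+ b)) ([k+1]*[n+1]C[k+1]≡[n+1]*nCk n k)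
                                        ([k+1]*[n+1]C[k+1]≡[n+1]*nCk n (suc k)) ⟩
  X ℕ.+ (suc n ℕ.* (n C k) ℕ.+ suc n ℕ.* (n C suc k))
    ≡⟨ cong (X ℕ.+_) (sym (ℕ.*-distribˡ-+ (suc n) (n C k) (n C suc k))) ⟩
  X ℕ.+ suc n ℕ.* (n C k ℕ.+ n C suc k)
    ≡⟨ cong (λ a → X ℕ.+ suc n ℕ.* a) (nCk+nC[k+1]≡[n+1]C[k+1] n k) ⟩
  suc (suc n) ℕ.* X ∎
  where
  open ≡-Reasoning
  X = suc n C suc k
  W = suc n C suc (suc k)
  split : ∀ a X W → suc a ℕ.* (X ℕ.+ W) ≡ X ℕ.+ (a ℕ.* X ℕ.+ suc a ℕ.* W)
  split = ℕ-Solver.solve-∀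

k*[n+1]Ck+[n+1]*nCk≡[n+1]*[n+1]Ck : ∀ n k →
  k ℕ.* (suc n C k) ℕ.+ suc n ℕ.* (n C k) ≡ suc n ℕ.* (suc n C k)
k*[n+1]Ck+[n+1]*nCk≡[n+1]*[n+1]Ck n zero = refl
k*[n+1]Ck+[n+1]*nCk≡[n+1]*[n+1]Ck n (suc k) = begin
  suc k ℕ.* (suc n C suc k) ℕ.+ suc n ℕ.* (n C suc k)
    ≡⟨ cong (ℕ._+ suc n ℕ.* (n C suc k)) ([k+1]*[n+1]C[k+1]≡[n+1]*nCk n k) ⟩
  suc n ℕ.* (n C k) ℕ.+ suc n ℕ.* (n C suc k)
    ≡⟨ sym (ℕ.*-distribˡ-+ (suc n) (n C k) (n C suc k)) ⟩
  suc n ℕ.* (n C k ℕ.+ n C suc k)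
    ≡⟨ cong (suc n ℕ.*_) (nCk+nC[k+1]≡[n+1]C[k+1] n k) ⟩
  suc n ℕ.* (suc n C suc k) ∎
  where open ≡-Reasoning

binom₂ : ℕ → ℕ → ℕ
binom₂ n k = (n C k) ℕ.* 2 ^ (n ∸ k)

2*binom₂≡nCk*2^[1+n∸k] : ∀ n k → 2 ℕ.* binom₂ n k ≡ (n C k) ℕ.* 2 ^ (suc n ∸ k)
2*binom₂≡nCk*2^[1+n∸k] n k with ℕ.≤-<-connex k n
... | inj₁ k≤n = begin
  2 ℕ.* ((n C k) ℕ.* 2 ^ (n ∸ k))  ≡⟨ x∙yz≈y∙xz 2 (n C k) (2 ^ (n ∸ k)) ⟩
  (n C k) ℕ.* 2 ^ suc (n ∸ k)      ≡⟨ cong (λ e → (n C k) ℕ.* 2 ^ e) (sym (ℕ.+-∸-assoc 1 k≤n)) ⟩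
  (n C k) ℕ.* 2 ^ (suc n ∸ k)      ∎
  where open ≡-Reasoning
... | inj₂ n<k = trans (cong (λ c → 2 ℕ.* (c ℕ.* 2 ^ (n ∸ k))) (k>n⇒nCk≡0 n<k))
                       (cong (ℕ._* 2 ^ (suc n ∸ k)) (sym (k>n⇒nCk≡0 n<k)))

binom₂-pascal : ∀ n k → binom₂ (suc n) (suc k) ≡ 2 ℕ.* binom₂ n (suc k) ℕ.+ binom₂ n k
binom₂-pascal n k = begin
  (suc n C suc k) ℕ.* 2 ^ (n ∸ k)
    ≡⟨ cong (ℕ._* 2 ^ (n ∸ k)) (sym (nCk+nC[k+1]≡[n+1]C[k+1] n k)) ⟩
  (n C k ℕ.+ n C suc k) ℕ.* 2 ^ (n ∸ k)
    ≡⟨ ℕ.*-distribʳ-+ (2 ^ (n ∸ k)) (n C k) (n C suc k) ⟩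
  binom₂ n k ℕ.+ (n C suc k) ℕ.* 2 ^ (n ∸ k)
    ≡⟨ cong (binom₂ n k ℕ.+_) (sym (2*binom₂≡nCk*2^[1+n∸k] n (suc k))) ⟩
  binom₂ n k ℕ.+ 2 ℕ.* binom₂ n (suc k)
    ≡⟨ ℕ.+-comm (binom₂ n k) _ ⟩
  2 ℕ.* binom₂ n (suc k) ℕ.+ binom₂ n k ∎
  where open ≡-Reasoning

binom₂-absorption : ∀ n k → (suc n ℕ.+ k) ℕ.* binom₂ (suc n) k ℕ.+ 2 ℕ.* suc n ℕ.* binom₂ n k
                          ≡ 2 ℕ.* suc n ℕ.* binom₂ (suc n) k
binom₂-absorption n k = begin
  (N ℕ.+ k) ℕ.* (A ℕ.* P) ℕ.+ 2 ℕ.* N ℕ.* binom₂ n k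
    ≡⟨ regroup N k A P (binom₂ n k) ⟩
  (N ℕ.* A ℕ.+ k ℕ.* A) ℕ.* P ℕ.+ N ℕ.* (2 ℕ.* binom₂ n k)
    ≡⟨ cong (λ x → (N ℕ.* A ℕ.+ k ℕ.* A) ℕ.* P ℕ.+ N ℕ.* x) (2*binom₂≡nCk*2^[1+n∸k] n k) ⟩
  (N ℕ.* A ℕ.+ k ℕ.* A) ℕ.* P ℕ.+ N ℕ.* ((n C k) ℕ.* P)
    ≡⟨ collect N k A P (n C k) ⟩
  (N ℕ.* A ℕ.+ (k ℕ.* A ℕ.+ N ℕ.* (n C k))) ℕ.* P
    ≡⟨ cong (λ x → (N ℕ.* A ℕ.+ x) ℕ.* P) (k*[n+1]Ck+[n+1]*nCk≡[n+1]*[n+1]Ck n k) ⟩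
  (N ℕ.* A ℕ.+ N ℕ.* A) ℕ.* P
    ≡⟨ double N A P ⟩
  2 ℕ.* N ℕ.* (A ℕ.* P) ∎
  where
  open ≡-Reasoning
  N = suc n
  A = suc n C k
  P = 2 ^ (suc n ∸ k)
  regroup : ∀ N k A P B → (N ℕ.+ k) ℕ.* (A ℕ.* P) ℕ.+ 2 ℕ.* N ℕ.* B
                        ≡ (N ℕ.* A ℕ.+ k ℕ.* A) ℕ.* P ℕ.+ N ℕ.* (2 ℕ.* B)
  regroup = ℕ-Solver.solve-∀
  collect : ∀ N k A P B → (N ℕ.* A ℕ.+ k ℕ.* A) ℕ.* P ℕ.+ N ℕ.* (B ℕ.* P)
                        ≡ (N ℕ.* A ℕ.+ (k ℕ.* A ℕ.+ N ℕ.* B)) ℕ.* P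
  collect = ℕ-Solver.solve-∀
  double : ∀ N A P → (N ℕ.* A ℕ.+ N ℕ.* A) ℕ.* P ≡ 2 ℕ.* N ℕ.* (A ℕ.* P)
  double = ℕ-Solver.solve-∀

binom₂-difference : ∀ n k →
  + (suc n ℕ.+ k) * + binom₂ (suc n) k ≡ (+ binom₂ (suc n) k - + binom₂ n k) * + (2 ℕ.* suc n)
binom₂-difference n k = begin
  + (suc n ℕ.+ k) * + binom₂ (suc n) k  ≡⟨ ℤ.pos-* (suc n ℕ.+ k) _ ⟨
  + X                                   ≡⟨ add-sub (+ X) (+ Y) ⟩
  + X + + Y - + Y                       ≡⟨ cong (_- + Y) (ℤ.pos-+ X Y) ⟨
  + (X ℕ.+ Y) - + Y                     ≡⟨ cong (λ z → + z - + Y) (binom₂-absorption n k) ⟩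
  + Z - + Y                             ≡⟨ cong₂ _-_ (ℤ.pos-* 2n (binom₂ (suc n) k))
                                                     (ℤ.pos-* 2n (binom₂ n k)) ⟩
  + 2n * + binom₂ (suc n) k - + 2n * + binom₂ n k
                                        ≡⟨ factor (+ 2n) (+ binom₂ (suc n) k) (+ binom₂ n k) ⟩
  (+ binom₂ (suc n) k - + binom₂ n k) * + 2n ∎
  where
  open ≡-Reasoning
  2n = 2 ℕ.* suc n
  X = (suc n ℕ.+ k) ℕ.* binom₂ (suc n) k
  Y = 2 ℕ.* suc n ℕ.* binom₂ n k
  Z = 2 ℕ.* suc n ℕ.* binom₂ (suc n) k
  add-sub : ∀ x y → x ≡ x + y - y
  add-sub = solve-∀
  factor : ∀ t a b → t * a - t * b ≡ (a - b) * t
  factor = solve-∀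

m/n<o⇒m<o*n : ∀ {m n o} .{{_ : NonZero n}} → m ℕ./ n < o → m < o ℕ.* n
m/n<o⇒m<o*n {m} {n} {o} m/n<o = ℕ.≰⇒> λ o*n≤m →
  ℕ.<⇒≱ m/n<o (subst (_≤ m ℕ./ n) (m*n/n≡m o n) (/-monoˡ-≤ n o*n≤m))

∑ : ℕ → (ℕ → ℤ) → ℤ
∑ zero    f = 0ℤ
∑ (suc L) f = f 0 + ∑ L (f ∘ suc)

syntax ∑ L (λ j → e) = ∑[ j < L ] e

∑-cong : ∀ L {f g : ℕ → ℤ} → (∀ j → f j ≡ g j) → ∑ L f ≡ ∑ L g
∑-cong zero    f≗g = refl
∑-cong (suc L) f≗g = cong₂ _+_ (f≗g 0) (∑-cong L (f≗g ∘ suc))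

∑-*ˡ : ∀ a L (f : ℕ → ℤ) → ∑[ j < L ] (a * f j) ≡ a * ∑ L f
∑-*ˡ a zero    f = sym (ℤ.*-zeroʳ a)
∑-*ˡ a (suc L) f = trans (cong (_+_ (a * f 0)) (∑-*ˡ a L (f ∘ suc))) (sym (ℤ.*-distribˡ-+ a (f 0) _))

∑-distrib-- : ∀ L (f g : ℕ → ℤ) → ∑[ j < L ] (f j - g j) ≡ ∑ L f - ∑ L g
∑-distrib-- zero    f g = refl
∑-distrib-- (suc L) f g =
  trans (cong (_+_ (f 0 - g 0)) (∑-distrib-- L (f ∘ suc) (g ∘ suc))) (interchange (f 0) (g 0) _ _)
  where
  interchange : ∀ a b c d → a - b + (c - d) ≡ a + c - (b + d)
  interchange = solve-∀

∑-stable : ∀ {f : ℕ → ℤ} A L → (∀ j → A ≤ j → f j ≡ 0ℤ) → A ≤ L → ∑ L f ≡ ∑ A f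
∑-stable zero    zero    _ _ = refl
∑-stable zero    (suc L) f≡0 _ =
  cong₂ _+_ (f≡0 0 z≤n) (∑-stable 0 L (λ j _ → f≡0 (suc j) z≤n) z≤n)
∑-stable {f} (suc A) (suc L) f≡0 (s≤s A≤L) =
  cong (_+_ (f 0)) (∑-stable A L (λ j A≤j → f≡0 (suc j) (s≤s A≤j)) A≤L)

sumℤ : List ℤ → ℤ
sumℤ = foldr _+_ 0ℤ

pos-sum : ∀ ns → + sum ns ≡ sumℤ (map +_ ns)
pos-sum ns = trans (foldr-fusion +_ 0 ℤ.pos-+ ns) (sym (foldr-map _+_ +_ 0ℤ ns))

Δ : (ℕ → ℤ) → ℕ → ℤ
Δ G n = G (suc n) - G n

telescope : ∀ (G : ℕ → ℤ) t n → sumℤ (take t (applyDownFrom (Δ G) n)) ≡ G n - G (n ∸ t)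
telescope G zero    n       = sym (ℤ.+-inverseʳ (G n))
telescope G (suc t) zero    = sym (ℤ.+-inverseʳ (G 0))
telescope G (suc t) (suc n) =
  trans (cong (_+_ (Δ G n)) (telescope G t n)) (cancel (G (suc n)) (G n) (G (n ∸ t)))
  where
  cancel : ∀ a b c → a - b + (b - c) ≡ a - c
  cancel = solve-∀

kbHist≡applyDownFrom : ∀ k (a : ℕ → ℤ) → a 0 ≡ + 1 →
          (∀ n → a (suc n) ≡ sumℤ (take k (applyDownFrom a (suc n)))) →
          ∀ n → map +_ (kbHist k n) ≡ applyDownFrom a (suc n)
kbHist≡applyDownFrom k a a₀ a-rec zero    = cong (_∷ []) (sym a₀)
kbHist≡applyDownFrom k a a₀ a-rec (suc n) = cong₂ _∷_ head-eq tail-eq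
  where
  open ≡-Reasoning
  tail-eq = kbHist≡applyDownFrom k a a₀ a-rec n
  head-eq : + sum (take k (kbHist k n)) ≡ a (suc n)
  head-eq = begin
    + sum (take k (kbHist k n))                  ≡⟨ pos-sum (take k (kbHist k n)) ⟩
    sumℤ (map +_ (take k (kbHist k n)))          ≡⟨ cong sumℤ (take-map k (kbHist k n)) ⟨
    sumℤ (take k (map +_ (kbHist k n)))          ≡⟨ cong (sumℤ ∘ take k) tail-eq ⟩
    sumℤ (take k (applyDownFrom a (suc n)))      ≡⟨ a-rec n ⟨
    a (suc n)                                    ∎

kbonacci-unique : ∀ k (a : ℕ → ℤ) → a 0 ≡ + 1 →
            (∀ n → a (suc n) ≡ sumℤ (take k (applyDownFrom a (suc n)))) →
            ∀ n → + kbonacci k (+ n) ≡ a n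
kbonacci-unique k a a₀ a-rec zero    = ∷-injectiveˡ (kbHist≡applyDownFrom k a a₀ a-rec zero)
kbonacci-unique k a a₀ a-rec (suc n) = ∷-injectiveˡ (kbHist≡applyDownFrom k a a₀ a-rec (suc n))

kbonacci≡Δ : ∀ k (G : ℕ → ℤ) → G 0 ≡ 0ℤ → G 1 ≡ + 1 →
             (∀ n → G (suc (suc n)) ≡ + 2 * G (suc n) - G (suc n ∸ k)) →
             ∀ n → + kbonacci k (+ n) ≡ Δ G n
kbonacci≡Δ k G G₀ G₁ G-rec = kbonacci-unique k (Δ G) (cong₂ _-_ G₁ G₀) Δ-rec
  where
  Δ-rec : ∀ n → Δ G (suc n) ≡ sumℤ (take k (applyDownFrom (Δ G) (suc n)))
  Δ-rec n = begin
    G (suc (suc n)) - G (suc n)                     ≡⟨ cong (_- G (suc n)) (G-rec n) ⟩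
    + 2 * G (suc n) - G (suc n ∸ k) - G (suc n)     ≡⟨ simplify (G (suc n)) (G (suc n ∸ k)) ⟩
    G (suc n) - G (suc n ∸ k)                       ≡⟨ telescope G k (suc n) ⟨
    sumℤ (take k (applyDownFrom (Δ G) (suc n)))     ∎
    where
    open ≡-Reasoning
    simplify : ∀ a b → + 2 * a - b - a ≡ a - b
    simplify = solve-∀

ι : ℤ → ℚ
ι z = z / 1

toℚᵘ-ι : ∀ z → toℚᵘ (ι z) ℚᵘ.≃ ℚᵘ.mkℚᵘ z 0
toℚᵘ-ι z = ℚ.toℚᵘ-fromℚᵘ (ℚᵘ.mkℚᵘ z 0)

ι-+ : ∀ a b → ι (a + b) ≡ ι a ℚ.+ ι b
ι-+ a b = ℚ.toℚᵘ-injective (begin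
  toℚᵘ (ι (a + b))                        ≈⟨ toℚᵘ-ι (a + b) ⟩
  ℚᵘ.mkℚᵘ (a + b) 0                       ≈⟨ ℚᵘ.*≡* (unit a b) ⟩
  ℚᵘ.mkℚᵘ a 0 ℚᵘ.+ ℚᵘ.mkℚᵘ b 0           ≈⟨ ℚᵘ.+-cong (toℚᵘ-ι a) (toℚᵘ-ι b) ⟨
  toℚᵘ (ι a) ℚᵘ.+ toℚᵘ (ι b)             ≈⟨ ℚ.toℚᵘ-homo-+ (ι a) (ι b) ⟨
  toℚᵘ (ι a ℚ.+ ι b)                      ∎)
  where
  open ℚᵘ.≃-Reasoning
  unit : ∀ a b → (a + b) * + 1 ≡ (a * + 1 + b * + 1) * + 1
  unit = solve-∀

frac*ι*ι≡ι : ∀ a d .{{_ : NonZero d}} x y z →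
             a * x * y ≡ z * + d → frac a d ℚ.* ι x ℚ.* ι y ≡ ι z
frac*ι*ι≡ι a (suc b) x y z eq = ℚ.toℚᵘ-injective (begin
  toℚᵘ (frac a (suc b) ℚ.* ι x ℚ.* ι y)
    ≈⟨ ℚ.toℚᵘ-homo-* (frac a (suc b) ℚ.* ι x) (ι y) ⟩
  toℚᵘ (frac a (suc b) ℚ.* ι x) ℚᵘ.* toℚᵘ (ι y)
    ≈⟨ ℚᵘ.*-cong (ℚ.toℚᵘ-homo-* (frac a (suc b)) (ι x)) (toℚᵘ-ι y) ⟩
  toℚᵘ (frac a (suc b)) ℚᵘ.* toℚᵘ (ι x) ℚᵘ.* ℚᵘ.mkℚᵘ y 0
    ≈⟨ ℚᵘ.*-cong (ℚᵘ.*-cong (ℚ.toℚᵘ-fromℚᵘ (ℚᵘ.mkℚᵘ a b)) (toℚᵘ-ι x)) ℚᵘ.≃-refl ⟩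
  ℚᵘ.mkℚᵘ a b ℚᵘ.* ℚᵘ.mkℚᵘ x 0 ℚᵘ.* ℚᵘ.mkℚᵘ y 0
    ≈⟨ ℚᵘ.*≡* cross ⟩
  ℚᵘ.mkℚᵘ z 0
    ≈⟨ toℚᵘ-ι z ⟨
  toℚᵘ (ι z) ∎)
  where
  open ℚᵘ.≃-Reasoning
  cross : a * x * y * + 1 ≡ z * + (suc b ℕ.* 1 ℕ.* 1)
  cross = trans (ℤ.*-identityʳ _)
                (trans eq (cong (λ d → z * + d) (sym (trans (ℕ.*-identityʳ _) (ℕ.*-identityʳ _)))))

ι-∑ : ∀ L (f : ℕ → ℤ) {h : ℕ → ℚ} →
      (∀ j → h j ≡ ι (f j)) → sumℚ (applyUpTo h L) ≡ ι (∑ L f)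
ι-∑ zero    f h≗ιf = refl
ι-∑ (suc L) f h≗ιf =
  trans (cong₂ ℚ._+_ (h≗ιf 0) (ι-∑ L (f ∘ suc) (h≗ιf ∘ suc))) (sym (ι-+ (f 0) (∑ L (f ∘ suc))))

sign-suc : ∀ j → sign (suc j) ≡ - sign j
sign-suc zero          = refl
sign-suc (suc zero)    = refl
sign-suc (suc (suc j)) = sign-suc j

σ : ℕ → ℕ → ℕ → ℤ
σ k n j = sign j * + binom₂ (n ∸ j ℕ.* k) j

S : ℕ → ℕ → ℤ
S k n = ∑[ j < suc (n ℕ./ suc k) ] σ k n j

σ-vanishes : ∀ k n j → n ∸ j ℕ.* k < j → σ k n j ≡ 0ℤ
σ-vanishes k n j lt =
  trans (cong (λ c → sign j * + (c ℕ.* 2 ^ (n ∸ j ℕ.* k ∸ j))) (k>n⇒nCk≡0 lt)) (ℤ.*-zeroʳ (sign j))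

σ-vanishes-∸≡0 : ∀ k n j → n ∸ suc j ℕ.* k ≡ 0 → σ k n (suc j) ≡ 0ℤ
σ-vanishes-∸≡0 k n j n∸jk≡0 = σ-vanishes k n (suc j) (subst (_< suc j) (sym n∸jk≡0) z<s)

σ-vanishes-beyond : ∀ k n j → n ℕ./ suc k < j → σ k n j ≡ 0ℤ
σ-vanishes-beyond k n zero    ()
σ-vanishes-beyond k n (suc j) lt = σ-vanishes k n (suc j) (ℕ.m<n+o⇒m∸n<o n (suc j ℕ.* k) n<jk+j)
  where
  n<jk+j : n < suc j ℕ.* k ℕ.+ suc j
  n<jk+j = subst (n <_) (trans (ℕ.*-suc (suc j) k) (ℕ.+-comm (suc j) _)) (m/n<o⇒m<o*n lt)

S≡∑ : ∀ k n L → n ℕ./ suc k < L → S k n ≡ ∑ L (σ k n)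
S≡∑ k n L lt = sym (∑-stable (suc (n ℕ./ suc k)) L (σ-vanishes-beyond k n) lt)

σ-head : ∀ k n → σ k n 0 ≡ + 2 ^ n
σ-head k n = trans (ℤ.*-identityˡ _) (cong +_ (ℕ.*-identityˡ (2 ^ n)))

σ-rec : ∀ {k n} j → k ≤ n → σ k (suc n) (suc j) ≡ + 2 * σ k n (suc j) - σ k (n ∸ k) j
σ-rec {k} {n} j k≤n with ℕ.≤-<-connex (suc j ℕ.* k) n
... | inj₁ jk≤n = begin
  sign (suc j) * + binom₂ (suc n ∸ suc j ℕ.* k) (suc j)
    ≡⟨ cong₂ (λ s m → s * + binom₂ m (suc j)) (sign-suc j) (ℕ.+-∸-assoc 1 jk≤n) ⟩
  - sign j * + binom₂ (suc q) (suc j)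
    ≡⟨ cong (λ b → - sign j * + b) (binom₂-pascal q j) ⟩
  - sign j * + (2 ℕ.* binom₂ q (suc j) ℕ.+ binom₂ q j)
    ≡⟨ cong (- sign j *_) (trans (ℤ.pos-+ (2 ℕ.* binom₂ q (suc j)) (binom₂ q j))
                                 (cong (_+ + binom₂ q j) (ℤ.pos-* 2 (binom₂ q (suc j))))) ⟩
  - sign j * (+ 2 * + binom₂ q (suc j) + + binom₂ q j)
    ≡⟨ expand (sign j) (+ binom₂ q (suc j)) (+ binom₂ q j) ⟩
  + 2 * (- sign j * + binom₂ q (suc j)) - sign j * + binom₂ q j
    ≡⟨ cong₂ (λ s m → + 2 * (s * + binom₂ q (suc j)) - sign j * + binom₂ m j)
             (sign-suc j) (ℕ.∸-+-assoc n k (j ℕ.* k)) ⟨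
  + 2 * σ k n (suc j) - σ k (n ∸ k) j ∎
  where
  open ≡-Reasoning
  q = n ∸ suc j ℕ.* k
  expand : ∀ s a b → - s * (+ 2 * a + b) ≡ + 2 * (- s * a) - s * b
  expand = solve-∀
σ-rec {k} {n} zero    k≤n | inj₂ n<k+0 =
  ⊥-elim (ℕ.<⇒≱ n<k+0 (subst (_≤ n) (sym (ℕ.+-identityʳ k)) k≤n))
σ-rec {k} {n} (suc j) k≤n | inj₂ n<jk = begin
  σ k (suc n) (suc (suc j))
    ≡⟨ σ-vanishes-∸≡0 k (suc n) (suc j) (ℕ.m≤n⇒m∸n≡0 n<jk) ⟩
  0ℤ
    ≡⟨ cong₂ (λ a b → + 2 * a - b) (σ-vanishes-∸≡0 k n (suc j) n∸jk≡0)
                                   (σ-vanishes-∸≡0 k (n ∸ k) j n∸k∸jk≡0) ⟨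
  + 2 * σ k n (suc (suc j)) - σ k (n ∸ k) (suc j) ∎
  where
  open ≡-Reasoning
  n∸jk≡0 : n ∸ suc (suc j) ℕ.* k ≡ 0
  n∸jk≡0 = ℕ.m≤n⇒m∸n≡0 (ℕ.<⇒≤ n<jk)
  n∸k∸jk≡0 : n ∸ k ∸ suc j ℕ.* k ≡ 0
  n∸k∸jk≡0 = trans (ℕ.∸-+-assoc n k (suc j ℕ.* k)) n∸jk≡0

S-singleton : ∀ {k n} → n ≤ k → S k n ≡ + 2 ^ n
S-singleton {k} {n} n≤k = begin
  S k n           ≡⟨ S≡∑ k n 1 (s≤s (ℕ.≤-reflexive (m<n⇒m/n≡0 (s≤s n≤k)))) ⟩
  σ k n 0 + 0ℤ    ≡⟨ ℤ.+-identityʳ _ ⟩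
  σ k n 0         ≡⟨ σ-head k n ⟩
  + 2 ^ n         ∎
  where open ≡-Reasoning

S-rec : ∀ {k n} → k ≤ n → S k (suc n) ≡ + 2 * S k n - S k (n ∸ k)
S-rec {k} {n} k≤n = begin
  S k (suc n)
    ≡⟨ S≡∑ k (suc n) (suc (suc n)) (s≤s (m/n≤m (suc n) (suc k))) ⟩
  σ k (suc n) 0 + ∑[ j < suc n ] σ k (suc n) (suc j)
    ≡⟨ cong₂ _+_ (doubled-head) (∑-cong (suc n) (λ j → σ-rec j k≤n)) ⟩
  + 2 * σ k n 0 + ∑[ j < suc n ] (+ 2 * σ k n (suc j) - σ k (n ∸ k) j)
    ≡⟨ cong (_+_ (+ 2 * σ k n 0)) split-tail ⟩
  + 2 * σ k n 0 + (+ 2 * ∑[ j < suc n ] σ k n (suc j) - ∑ (suc n) (σ k (n ∸ k)))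
    ≡⟨ regroup (σ k n 0) (∑[ j < suc n ] σ k n (suc j)) (∑ (suc n) (σ k (n ∸ k))) ⟩
  + 2 * ∑ (suc (suc n)) (σ k n) - ∑ (suc n) (σ k (n ∸ k))
    ≡⟨ cong₂ (λ a b → + 2 * a - b) (S≡∑ k n (suc (suc n)) n/[k+1]<2+n)
                                   (S≡∑ k (n ∸ k) (suc n) [n∸k]/[k+1]<1+n) ⟨
  + 2 * S k n - S k (n ∸ k) ∎
  where
  open ≡-Reasoning
  n/[k+1]<2+n : n ℕ./ suc k < suc (suc n)
  n/[k+1]<2+n = s≤s (ℕ.m≤n⇒m≤1+n (m/n≤m n (suc k)))
  [n∸k]/[k+1]<1+n : (n ∸ k) ℕ./ suc k < suc n
  [n∸k]/[k+1]<1+n = s≤s (ℕ.≤-trans (m/n≤m (n ∸ k) (suc k)) (ℕ.m∸n≤m n k))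
  split-tail : ∑[ j < suc n ] (+ 2 * σ k n (suc j) - σ k (n ∸ k) j)
             ≡ + 2 * ∑[ j < suc n ] σ k n (suc j) - ∑ (suc n) (σ k (n ∸ k))
  split-tail = trans (∑-distrib-- (suc n) (λ j → + 2 * σ k n (suc j)) (σ k (n ∸ k)))
                     (cong (_- ∑ (suc n) (σ k (n ∸ k))) (∑-*ˡ (+ 2) (suc n) (σ k n ∘ suc)))
  doubled-head : σ k (suc n) 0 ≡ + 2 * σ k n 0
  doubled-head = trans (σ-head k (suc n))
                       (trans (ℤ.pos-* 2 (2 ^ n)) (cong (+ 2 *_) (sym (σ-head k n))))
  regroup : ∀ a b c → + 2 * a + (+ 2 * b - c) ≡ + 2 * (a + b) - c
  regroup = solve-∀

S′ : ℕ → ℕ → ℤ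
S′ k zero    = 0ℤ
S′ k (suc n) = S k n

S′-rec : ∀ k n → S′ k (suc (suc n)) ≡ + 2 * S′ k (suc n) - S′ k (suc n ∸ k)
S′-rec k n with ℕ.<-≤-connex n k
... | inj₁ n<k rewrite ℕ.m≤n⇒m∸n≡0 n<k = begin
  S k (suc n)          ≡⟨ S-singleton n<k ⟩
  + 2 ^ suc n          ≡⟨ ℤ.pos-* 2 (2 ^ n) ⟩
  + 2 * + 2 ^ n        ≡⟨ cong (+ 2 *_) (S-singleton (ℕ.<⇒≤ n<k)) ⟨
  + 2 * S k n          ≡⟨ ℤ.+-identityʳ _ ⟨
  + 2 * S k n - 0ℤ     ∎
  where open ≡-Reasoning
... | inj₂ k≤n rewrite ℕ.+-∸-assoc 1 k≤n = S-rec k≤n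

-- term k n j = termAt j (n - jk) (n - j(k+1)) when n ≠ 0, so that δ₀ n = 0.
termAt : ℕ → ℕ → ℕ → ℚ
termAt j m e = frac (sign j * + (m ℕ.+ j ℕ.+ 0)) (2 ℕ.* m ℕ.+ 0) ℚ.* ι (+ (m C j)) ℚ.* ι (+ 2 ^ e)

termAt-suc : ∀ j m →
  termAt j (suc m) (suc m ∸ j) ≡ ι (sign j * + binom₂ (suc m) j - sign j * + binom₂ m j)
termAt-suc j m =
  frac*ι*ι≡ι (s * + (suc m ℕ.+ j ℕ.+ 0)) (2 ℕ.* suc m ℕ.+ 0) (+ (suc m C j)) (+ 2 ^ (suc m ∸ j))
             (s * + binom₂ (suc m) j - s * + binom₂ m j) (begin
  s * + (suc m ℕ.+ j ℕ.+ 0) * + (suc m C j) * + 2 ^ (suc m ∸ j)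
    ≡⟨ cong (λ w → s * + w * + (suc m C j) * + 2 ^ (suc m ∸ j)) (ℕ.+-identityʳ _) ⟩
  s * + (suc m ℕ.+ j) * + (suc m C j) * + 2 ^ (suc m ∸ j)
    ≡⟨ reassoc s (+ (suc m ℕ.+ j)) (+ (suc m C j)) (+ 2 ^ (suc m ∸ j)) ⟩
  s * (+ (suc m ℕ.+ j) * (+ (suc m C j) * + 2 ^ (suc m ∸ j)))
    ≡⟨ cong (λ w → s * (+ (suc m ℕ.+ j) * w)) (ℤ.pos-* (suc m C j) (2 ^ (suc m ∸ j))) ⟨
  s * (+ (suc m ℕ.+ j) * + binom₂ (suc m) j)
    ≡⟨ cong (s *_) (binom₂-difference m j) ⟩
  s * ((+ binom₂ (suc m) j - + binom₂ m j) * + (2 ℕ.* suc m))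
    ≡⟨ distrib s (+ binom₂ (suc m) j) (+ binom₂ m j) (+ (2 ℕ.* suc m)) ⟩
  (s * + binom₂ (suc m) j - s * + binom₂ m j) * + (2 ℕ.* suc m)
    ≡⟨ cong (λ w → (s * + binom₂ (suc m) j - s * + binom₂ m j) * + w) (ℕ.+-identityʳ _) ⟨
  (s * + binom₂ (suc m) j - s * + binom₂ m j) * + (2 ℕ.* suc m ℕ.+ 0) ∎)
  where
  open ≡-Reasoning
  s = sign j
  reassoc : ∀ s x a p → s * x * a * p ≡ s * (x * (a * p))
  reassoc = solve-∀
  distrib : ∀ s a b t → s * ((a - b) * t) ≡ (s * a - s * b) * t
  distrib = solve-∀

termAt-zero : ∀ j e → termAt (suc j) 0 e ≡ ι 0ℤ
termAt-zero j e =
  trans (cong (ℚ._* ι (+ 2 ^ e)) (ℚ.*-zeroˡ (ι (+ (0 C suc j))))) (ℚ.*-zeroˡ (ι (+ 2 ^ e)))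

term≡ι[σ-σ] : ∀ k n j → term k (suc n) j ≡ ι (σ k (suc n) j - σ k n j)
term≡ι[σ-σ] k n j with ℕ.≤-<-connex (j ℕ.* k) n
... | inj₁ jk≤n = begin
  termAt j (suc n ∸ j ℕ.* k) (suc n ∸ j ℕ.* (k ℕ.+ 1))
    ≡⟨ cong₂ (termAt j) m≡ e≡ ⟩
  termAt j (suc m) (suc m ∸ j)
    ≡⟨ termAt-suc j m ⟩
  ι (sign j * + binom₂ (suc m) j - sign j * + binom₂ m j)
    ≡⟨ cong (λ w → ι (sign j * + binom₂ w j - σ k n j)) m≡ ⟨
  ι (σ k (suc n) j - σ k n j) ∎
  where
  open ≡-Reasoning
  m = n ∸ j ℕ.* k
  m≡ : suc n ∸ j ℕ.* k ≡ suc m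
  m≡ = ℕ.+-∸-assoc 1 jk≤n
  j[k+1]≡jk+j : j ℕ.* (k ℕ.+ 1) ≡ j ℕ.* k ℕ.+ j
  j[k+1]≡jk+j = trans (ℕ.*-distribˡ-+ j k 1) (cong (j ℕ.* k ℕ.+_) (ℕ.*-identityʳ j))
  e≡ : suc n ∸ j ℕ.* (k ℕ.+ 1) ≡ suc m ∸ j
  e≡ = begin
    suc n ∸ j ℕ.* (k ℕ.+ 1)  ≡⟨ cong (suc n ∸_) j[k+1]≡jk+j ⟩
    suc n ∸ (j ℕ.* k ℕ.+ j)  ≡⟨ ℕ.∸-+-assoc (suc n) (j ℕ.* k) j ⟨
    suc n ∸ j ℕ.* k ∸ j      ≡⟨ cong (_∸ j) m≡ ⟩
    suc m ∸ j                ∎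
term≡ι[σ-σ] k n (suc j) | inj₂ n<jk = begin
  termAt (suc j) (suc n ∸ suc j ℕ.* k) e  ≡⟨ cong (λ M → termAt (suc j) M e) 1+n∸jk≡0 ⟩
  termAt (suc j) 0 e                      ≡⟨ termAt-zero j e ⟩
  ι 0ℤ                                    ≡⟨ cong ι (cong₂ _-_ (σ-vanishes-∸≡0 k (suc n) j 1+n∸jk≡0)
                                                              (σ-vanishes-∸≡0 k n j n∸jk≡0)) ⟨
  ι (σ k (suc n) (suc j) - σ k n (suc j)) ∎
  where
  open ≡-Reasoning
  e = suc n ∸ suc j ℕ.* (k ℕ.+ 1)
  1+n∸jk≡0 : suc n ∸ suc j ℕ.* k ≡ 0
  1+n∸jk≡0 = ℕ.m≤n⇒m∸n≡0 n<jk
  n∸jk≡0 : n ∸ suc j ℕ.* k ≡ 0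
  n∸jk≡0 = ℕ.m≤n⇒m∸n≡0 (ℕ.<⇒≤ n<jk)

mainTheorem3 : (k : ℕ) → k ≥ 1 → (n : ℕ) →
    (+ kbonacci k (+ n)) / 1 ≡ rhs k n
mainTheorem3 k _ zero    = refl
mainTheorem3 k _ (suc n) = begin
  ι (+ kbonacci k (+ suc n))
    ≡⟨ cong ι (kbonacci≡Δ k (S′ k) refl refl (S′-rec k) (suc n)) ⟩
  ι (S k (suc n) - S k n)
    ≡⟨ cong (λ s → ι (S k (suc n) - s)) (S≡∑ k n N n/[k+1]<N) ⟩
  ι (∑ N (σ k (suc n)) - ∑ N (σ k n))
    ≡⟨ cong ι (∑-distrib-- N (σ k (suc n)) (σ k n)) ⟨
  ι (∑[ j < N ] (σ k (suc n) j - σ k n j))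
    ≡⟨ ι-∑ N (λ j → σ k (suc n) j - σ k n j) (term≡ι[σ-σ] k n) ⟨
  sumℚ (applyUpTo (term k (suc n)) N)
    ≡⟨ cong sumℚ (map-applyUpTo id (term k (suc n)) N) ⟨
  rhs k (suc n) ∎
  where
  open ≡-Reasoning
  N = suc (suc n ℕ./ suc k)
  n/[k+1]<N : n ℕ./ suc k < N
  n/[k+1]<N = s≤s (/-monoˡ-≤ (suc k) (ℕ.n≤1+n n))
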